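{- Let $(V,\mathcal{L})$ be a pairwise balanced design and let $M=(V,\mathcal{H})$ be its associated rank 3 matroid, i.e. $\mathcal{H} = P_{\leq 2}(V) \cup \{X \in P_{3}(V) \mid X \not\subseteq B \text{ for all } B\in \mathcal{L}\}$. Define $$\varepsilon(M) = \{ X \subseteq V \mid \forall Y \in \mathcal{H} \cap P_{\leq 2}(X)\ \forall p \in V\setminus X:\ Y \cup \{ p \} \in \mathcal{H}\}.$$ Then $\varepsilon(M)$ is exactly the set of subsystems of $(V,\mathcal{L})$.
   Context: A pairwise balanced design (PBD) is a pair $(V,\mathcal{L})$ where $V$ is a finite set and $\mathcal{L}$ is a collection of subsets of $V$ (blocks), each of size at least 2, such that every pair of distinct points of $V$ lies in exactly one block. The degenerate cases $(\emptyset,\emptyset)$, $(V,\emptyset)$ with $|V|=1$, and $(V,\{V\})$ with $|V|>1$ are excluded. For distinct $x,y\in V$, $\overline{xy}$ denotes the unique block containing $x,y$. A subset $X\subseteq V$ is a subsystem if for all distinct $x,y\in X$ we have $\overline{xy}\subseteq X$. $P_n(V)$ (resp. $P_{\le n}(V)$) denotes the set of subsets of $V$ with exactly (resp. at most) $n$ elements, and $P_{\le n}(X)$ the subsets of $X$ with at most $n$ elements. -}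

module Defs where

open import Data.Nat using (ℕ; _≤_; _≥_)
open import Data.Fin using (Fin)
open import Data.Fin.Subset using (Subset; _∈_; _∉_; _⊆_; ∣_∣; _∪_; ⁅_⁆; ⊤)
open import Data.List using (List)
import Data.List.Membership.Propositional as LM
open import Data.Product using (Σ; _×_; ∃)
open import Relation.Binary.PropositionalEquality using (_≡_; _≢_)
open import Relation.Nullary using (¬_)
open import Function.Bundles using (_⇔_)

-- Points are Fin n; subsets of V are Data.Fin.Subset; the block collection
-- is a list of subsets (read as the set of its entries).
_∈L_ : ∀ {n} → Subset n → List (Subset n) → Set
B ∈L ℒ = B LM.∈ ℒ

record IsPBD (n : ℕ) (ℒ : List (Subset n)) : Set where
  field
    blockSize : ∀ B → B ∈L ℒ → ∣ B ∣ ≥ 2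
    pairCovered : ∀ x y → x ≢ y → Σ (Subset n) λ B → B ∈L ℒ × x ∈ B × y ∈ B
    pairUnique : ∀ x y → x ≢ y → ∀ B B′ → B ∈L ℒ → B′ ∈L ℒ →
                 x ∈ B → y ∈ B → x ∈ B′ → y ∈ B′ → B ≡ B′
    -- excluded degenerate cases
    notEmpty : ¬ (n ≡ 0)
    notPoint : ¬ (n ≡ 1)
    notTrivial : ¬ (∀ B → B ∈L ℒ → B ≡ ⊤)

Indep : ∀ {n} → List (Subset n) → Subset n → Set
Indep ℒ X = (∣ X ∣ ≤ 2) ⊎' (∣ X ∣ ≡ 3 × (∀ B → B ∈L ℒ → ¬ (X ⊆ B)))
  where
  open import Data.Sum using () renaming (_⊎_ to _⊎'_)

InEpsilon : ∀ {n} → List (Subset n) → Subset n → Set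
InEpsilon {n} ℒ X = ∀ (Y : Subset n) → Indep ℒ Y → ∣ Y ∣ ≤ 2 → Y ⊆ X →
                    ∀ (p : Fin n) → p ∉ X → Indep ℒ (Y ∪ ⁅ p ⁆)

Subsystem : ∀ {n} → List (Subset n) → Subset n → Set
Subsystem {n} ℒ X = ∀ (x y : Fin n) → x ∈ X → y ∈ X → x ≢ y →
                    ∀ B → B ∈L ℒ → x ∈ B → y ∈ B → B ⊆ X

module Submission where

-- Proof idea.  Both inclusions compare a point set with the triples of the
-- rank 3 matroid, and neither uses the PBD axioms: the equivalence holds for
-- every collection of blocks ℒ.
--
--  * A subsystem X lies in ε(M): take an independent Y ⊆ X with |Y| ≤ 2 and
--    p ∉ X.  If Y ∪ {p} is still of size ≤ 2 it is independent; otherwise it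
--    is a triple, Y consists of two distinct points x, y of X, and a block
--    containing Y ∪ {p} would be a block through x, y, hence inside X,
--    forcing p ∈ X.
--  * A member X of ε(M) is a subsystem: for distinct x, y ∈ X, a block B
--    through them and q ∈ B with q ∉ X, the pair {x,y} may be extended by q,
--    so {x,y,q} is independent; but it is a 3-set contained in the block B,
--    hence dependent.

open import Defs
open import Data.Nat using (ℕ; zero; suc; _≤_; _<_; _+_; z≤n; s≤s; s≤s⁻¹)
import Data.Nat.Properties as ℕP
open import Data.Fin using (Fin; zero; suc)
open import Data.Fin.Properties using (suc-injective)
open import Data.Fin.Subset
open import Data.Fin.Subset.Properties
open import Data.Vec using (_∷_; []; here; there)
open import Data.Bool using (true; false)
open import Data.List using (List)
open import Data.Product using (Σ; _×_; _,_; ∃)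
open import Data.Sum using (_⊎_; inj₁; inj₂)
open import Relation.Nullary using (¬_; yes; no; contradiction)
open import Relation.Binary.PropositionalEquality using (_≡_; _≢_; sym; cong; subst)
open import Function.Bundles using (_⇔_; mk⇔)

∣p∪q∣≤∣p∣+∣q∣ : ∀ {n} (p q : Subset n) → ∣ p ∪ q ∣ ≤ ∣ p ∣ + ∣ q ∣
∣p∪q∣≤∣p∣+∣q∣ [] [] = z≤n
∣p∪q∣≤∣p∣+∣q∣ (true ∷ p) (t ∷ q) =
  s≤s (ℕP.≤-trans (∣p∪q∣≤∣p∣+∣q∣ p q) (ℕP.+-monoʳ-≤ ∣ p ∣ (∣p∣≤∣x∷p∣ t q)))
∣p∪q∣≤∣p∣+∣q∣ (false ∷ p) (true ∷ q) =
  subst (suc ∣ p ∪ q ∣ ≤_) (sym (ℕP.+-suc ∣ p ∣ ∣ q ∣)) (s≤s (∣p∪q∣≤∣p∣+∣q∣ p q))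
∣p∪q∣≤∣p∣+∣q∣ (false ∷ p) (false ∷ q) = ∣p∪q∣≤∣p∣+∣q∣ p q

∣p∪⁅x⁆∣≤1+∣p∣ : ∀ {n} (p : Subset n) (x : Fin n) → ∣ p ∪ ⁅ x ⁆ ∣ ≤ suc ∣ p ∣
∣p∪⁅x⁆∣≤1+∣p∣ p x =
  subst (∣ p ∪ ⁅ x ⁆ ∣ ≤_) (ℕP.+-comm ∣ p ∣ 1)
    (subst (λ k → ∣ p ∪ ⁅ x ⁆ ∣ ≤ ∣ p ∣ + k) (∣⁅x⁆∣≡1 x) (∣p∪q∣≤∣p∣+∣q∣ p ⁅ x ⁆))

x∉p⇒∣p∣<∣p∪⁅x⁆∣ : ∀ {n} {p : Subset n} {x : Fin n} → x ∉ p → ∣ p ∣ < ∣ p ∪ ⁅ x ⁆ ∣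
x∉p⇒∣p∣<∣p∪⁅x⁆∣ {p = p} {x} x∉p =
  p⊂q⇒∣p∣<∣q∣ (p⊆p∪q ⁅ x ⁆ , x , q⊆p∪q p ⁅ x ⁆ (x∈⁅x⁆ x) , x∉p)

memberOfNonempty : ∀ {n} (S : Subset n) → 1 ≤ ∣ S ∣ → ∃ λ x → x ∈ S
memberOfNonempty (true ∷ S) _ = zero , here
memberOfNonempty (false ∷ S) h with memberOfNonempty S h
... | x , x∈S = suc x , there x∈S

twoDistinctMembers : ∀ {n} (S : Subset n) → 2 ≤ ∣ S ∣ →
                     Σ (Fin n) λ x → Σ (Fin n) λ y → x ∈ S × y ∈ S × x ≢ y
twoDistinctMembers (true ∷ S) (s≤s h) with memberOfNonempty S h
... | y , y∈S = zero , suc y , here , there y∈S , λ ()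
twoDistinctMembers (false ∷ S) h with twoDistinctMembers S h
... | x , y , x∈S , y∈S , x≢y =
  suc x , suc y , there x∈S , there y∈S , λ e → x≢y (suc-injective e)

⁅x⁆⊆ : ∀ {n} {r : Subset n} {x : Fin n} → x ∈ r → ⁅ x ⁆ ⊆ r
⁅x⁆⊆ {x = x} x∈r z∈⁅x⁆ = subst (_∈ _) (sym (x∈⁅y⁆⇒x≡y x z∈⁅x⁆)) x∈r

p∪⁅x⁆⊆ : ∀ {n} {p r : Subset n} {x : Fin n} → p ⊆ r → x ∈ r → p ∪ ⁅ x ⁆ ⊆ r
p∪⁅x⁆⊆ {p = p} {x = x} p⊆r x∈r z∈ with x∈p∪q⁻ p ⁅ x ⁆ z∈
... | inj₁ z∈p = p⊆r z∈p
... | inj₂ z∈⁅x⁆ = ⁅x⁆⊆ x∈r z∈⁅x⁆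

pair : ∀ {n} → Fin n → Fin n → Subset n
pair x y = ⁅ x ⁆ ∪ ⁅ y ⁆

pair⊆ : ∀ {n} {r : Subset n} {x y : Fin n} → x ∈ r → y ∈ r → pair x y ⊆ r
pair⊆ x∈r y∈r = p∪⁅x⁆⊆ (⁅x⁆⊆ x∈r) y∈r

∣pair∣≤2 : ∀ {n} (x y : Fin n) → ∣ pair x y ∣ ≤ 2
∣pair∣≤2 x y = ℕP.≤-trans (∣p∪⁅x⁆∣≤1+∣p∣ ⁅ x ⁆ y) (ℕP.≤-reflexive (cong suc (∣⁅x⁆∣≡1 x)))

∣triple∣≥3 : ∀ {n} {x y q : Fin n} → x ≢ y → q ∉ pair x y → 3 ≤ ∣ pair x y ∪ ⁅ q ⁆ ∣
∣triple∣≥3 {x = x} {y} x≢y q∉xy = ℕP.≤-trans (s≤s two≤∣xy∣) (x∉p⇒∣p∣<∣p∪⁅x⁆∣ q∉xy)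
  where
  two≤∣xy∣ : 2 ≤ ∣ pair x y ∣
  two≤∣xy∣ = subst (λ k → suc k ≤ ∣ pair x y ∣) (∣⁅x⁆∣≡1 x)
    (x∉p⇒∣p∣<∣p∪⁅x⁆∣ (x≢y⇒x∉⁅y⁆ (λ y≡x → x≢y (sym y≡x))))

oversizedExtension : ∀ {n} (Y : Subset n) (p : Fin n) → ∣ Y ∣ ≤ 2 →
                     ¬ (∣ Y ∪ ⁅ p ⁆ ∣ ≤ 2) → ∣ Y ∪ ⁅ p ⁆ ∣ ≡ 3 × 2 ≤ ∣ Y ∣
oversizedExtension Y p ∣Y∣≤2 big =
  ℕP.≤-antisym (ℕP.≤-trans upper (s≤s ∣Y∣≤2)) lower , s≤s⁻¹ (ℕP.≤-trans lower upper)
  where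
  upper : ∣ Y ∪ ⁅ p ⁆ ∣ ≤ suc ∣ Y ∣
  upper = ∣p∪⁅x⁆∣≤1+∣p∣ Y p
  lower : 3 ≤ ∣ Y ∪ ⁅ p ⁆ ∣
  lower = ℕP.≰⇒> big

blockDependent : ∀ {n} (ℒ : List (Subset n)) {B T : Subset n} →
                 B ∈L ℒ → T ⊆ B → 3 ≤ ∣ T ∣ → ¬ Indep ℒ T
blockDependent ℒ B∈ℒ T⊆B three≤∣T∣ (inj₁ ∣T∣≤2) = ℕP.<⇒≱ three≤∣T∣ ∣T∣≤2
blockDependent ℒ B∈ℒ T⊆B three≤∣T∣ (inj₂ (_ , notInBlock)) = notInBlock _ B∈ℒ T⊆B

module _ {n : ℕ} (ℒ : List (Subset n)) (X : Subset n) where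

  subsystem⇒inEpsilon : Subsystem ℒ X → InEpsilon ℒ X
  subsystem⇒inEpsilon closed Y _ ∣Y∣≤2 Y⊆X p p∉X with ∣ Y ∪ ⁅ p ⁆ ∣ ℕP.≤? 2
  ... | yes small = inj₁ small
  ... | no big with oversizedExtension Y p ∣Y∣≤2 big
  ...   | ∣Yp∣≡3 , two≤∣Y∣ with twoDistinctMembers Y two≤∣Y∣
  ...     | x , y , x∈Y , y∈Y , x≢y = inj₂ (∣Yp∣≡3 , notInBlock)
    where
    -- a block through Y ∪ {p} passes through x, y ∈ X, so lies in X ∌ p
    notInBlock : ∀ B → B ∈L ℒ → ¬ (Y ∪ ⁅ p ⁆ ⊆ B)
    notInBlock B B∈ℒ Yp⊆B = p∉X (closed x y (Y⊆X x∈Y) (Y⊆X y∈Y) x≢y B B∈ℒ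
      (Yp⊆B (p⊆p∪q ⁅ p ⁆ x∈Y)) (Yp⊆B (p⊆p∪q ⁅ p ⁆ y∈Y)) (Yp⊆B (q⊆p∪q Y ⁅ p ⁆ (x∈⁅x⁆ p))))

  inEpsilon⇒subsystem : InEpsilon ℒ X → Subsystem ℒ X
  inEpsilon⇒subsystem extendable x y x∈X y∈X x≢y B B∈ℒ x∈B y∈B {q} q∈B with q ∈? X
  ... | yes q∈X = q∈X
  ... | no q∉X = contradiction xyqIndep
                   (blockDependent ℒ B∈ℒ (p∪⁅x⁆⊆ (pair⊆ x∈B y∈B) q∈B) (∣triple∣≥3 x≢y q∉xy))
    where
    xyqIndep : Indep ℒ (pair x y ∪ ⁅ q ⁆)
    xyqIndep = extendable (pair x y) (inj₁ (∣pair∣≤2 x y)) (∣pair∣≤2 x y) (pair⊆ x∈X y∈X) q q∉X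
    q∉xy : q ∉ pair x y
    q∉xy q∈xy = q∉X (pair⊆ x∈X y∈X q∈xy)

theorem4p4 : (n : ℕ) (ℒ : List (Subset n)) → IsPBD n ℒ →
    ∀ (X : Subset n) → InEpsilon ℒ X ⇔ Subsystem ℒ X
theorem4p4 n ℒ _ X = mk⇔ (inEpsilon⇒subsystem ℒ X) (subsystem⇒inEpsilon ℒ X)
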